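{- Let $R$ be an integral domain, $K$ its field of fractions and $G=K^\times/R^\times$ its divisibility group. Let $x\in K^\times$. Then the relation $(\rhd_{\mathrm d})_x$ obtained from the system of Dedekind ideals $\rhd_{\mathrm d}$ by forcing $1\rhd_{\mathrm d}x$ is given by: for a nonempty finite $A\subseteq K^\times$ and $b\in K^\times$, $A\,(\rhd_{\mathrm d})_x\,b$ iff $b\in\langle A\rangle_{R[x]}$; that is, it is the system of Dedekind ideals with respect to the extension $R[x]$ of $R$.
   Context: $G$ is written multiplicatively, ordered by divisibility ($a\le b$ iff $b/a\in R$), elements represented by elements of $K^\times$. For a nonempty finite $A=\{a_1,\dots,a_k\}\subseteq K^\times$ and a subring $S\supseteq R$ of $K$, $\langle A\rangle_S=Sa_1+\dots+Sa_k$. The system of Dedekind ideals is $A\rhd_{\mathrm d}b$ iff $b\in\langle A\rangle_R$. A system of ideals for $G$ is a relation $\rhd$ between nonempty finite subsets of $G$ and $G$ with $a\rhd a$; $A\rhd b\Rightarrow A\cup A'\rhd b$; ($A\rhd c$ and $A\cup\{c\}\rhd b$) $\Rightarrow A\rhd b$; $a\le b\Rightarrow a\rhd b$; $A\rhd b\Rightarrow yA\rhd yb$. $(\rhd_{\mathrm d})_x$ is the finest system of ideals containing $\rhd_{\mathrm d}$ and satisfying $1\,(\rhd_{\mathrm d})_x\,x$. -}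

module Defs where

open import Level using (Level; _⊔_)
open import Algebra.Bundles using (CommutativeRing)
open import Data.Product using (Σ; ∃; _×_; _,_; proj₁; proj₂)
open import Data.List using (List; []; _∷_)
open import Data.List.NonEmpty using (List⁺; [_]; _∷⁺_; toList) renaming (map to map⁺)
open import Data.List.Relation.Unary.Any using (Any)
open import Data.List.Relation.Unary.All using (All)
open import Relation.Nullary using (¬_)
open import Relation.Unary using (Pred)
import Relation.Binary.Reasoning.Setoid as SetoidReasoning

module _ {c ℓ} (F : CommutativeRing c ℓ) where
  open CommutativeRing F

  record IsField : Set (c ⊔ ℓ) where
    field
      1≉0     : ¬ (1# ≈ 0#)
      inverse : ∀ x → ¬ (x ≈ 0#) → Σ Carrier λ y → x * y ≈ 1#

  -- K^× : nonzero elements of K (representatives of elements of G = K^×/R^×)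
  Kˣ : Set (c ⊔ ℓ)
  Kˣ = Σ Carrier λ a → ¬ (a ≈ 0#)

  record IsSubring {r} (R : Pred Carrier r) : Set (c ⊔ ℓ ⊔ r) where
    field
      resp      : ∀ {a b} → a ≈ b → R a → R b
      0∈        : R 0#
      1∈        : R 1#
      +-closed  : ∀ {a b} → R a → R b → R (a + b)
      neg-closed : ∀ {a} → R a → R (- a)
      *-closed  : ∀ {a b} → R a → R b → R (a * b)

  IsFractionFieldOf : ∀ {r} → Pred Carrier r → Set (c ⊔ ℓ ⊔ r)
  IsFractionFieldOf R =
    ∀ k → ∃ λ a → ∃ λ b → R a × R b × ¬ (b ≈ 0#) × k * b ≈ a

  Span : ∀ {s} → Pred Carrier s → List Carrier → Carrier → Set (c ⊔ ℓ ⊔ s)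
  Span {s} S []       b = Level.Lift (c ⊔ s) (b ≈ 0#)
  Span S (a ∷ as) b = ∃ λ s → ∃ λ d → S s × Span S as d × b ≈ s * a + d

  evalPoly : Carrier → List Carrier → Carrier
  evalPoly x []       = 0#
  evalPoly x (r ∷ rs) = r + x * evalPoly x rs

  Adjoin : ∀ {r} → Pred Carrier r → Carrier → Pred Carrier (c ⊔ ℓ ⊔ r)
  Adjoin R x k = ∃ λ (rs : List Carrier) → All R rs × k ≈ evalPoly x rs

  elems : List⁺ Kˣ → List Carrier
  elems A = Data.List.map proj₁ (toList A)
    where import Data.List

  _∈⟨_⟩[_] : ∀ {s} → Kˣ → List⁺ Kˣ → Pred Carrier s → Set (c ⊔ ℓ ⊔ s)
  b ∈⟨ A ⟩[ S ] = Span S (elems A) (proj₁ b)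

  _∈ₛ_ : Kˣ → List⁺ Kˣ → Set (c ⊔ ℓ)
  a ∈ₛ A = Any (λ a' → proj₁ a ≈ proj₁ a') (toList A)

  _⊆ₛ_ : List⁺ Kˣ → List⁺ Kˣ → Set (c ⊔ ℓ)
  A ⊆ₛ A' = ∀ a → a ∈ₛ A → a ∈ₛ A'

  module _ (isField : IsField) where
    open IsField isField
    open SetoidReasoning setoid

    *-nonzero : ∀ {a b} → ¬ (a ≈ 0#) → ¬ (b ≈ 0#) → ¬ (a * b ≈ 0#)
    *-nonzero {a} {b} a≉0 b≉0 ab≈0 = b≉0 (begin
      b             ≈⟨ sym (*-identityˡ b) ⟩
      1# * b        ≈⟨ *-congʳ (sym (proj₂ (inverse a a≉0))) ⟩
      (a * y) * b   ≈⟨ *-assoc a y b ⟩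
      a * (y * b)   ≈⟨ *-congˡ (*-comm y b) ⟩
      a * (b * y)   ≈⟨ sym (*-assoc a b y) ⟩
      (a * b) * y   ≈⟨ *-congʳ ab≈0 ⟩
      0# * y        ≈⟨ zeroˡ y ⟩
      0# ∎)
      where y = proj₁ (inverse a a≉0)

    oneˣ : Kˣ
    oneˣ = 1# , 1≉0

    _·_ : Kˣ → Kˣ → Kˣ
    (y , y≉0) · (a , a≉0) = y * a , *-nonzero y≉0 a≉0

    module _ {r} (R : Pred Carrier r) where

      _≤G_ : Kˣ → Kˣ → Set (c ⊔ ℓ ⊔ r)
      a ≤G b = ∃ λ s → R s × proj₁ b ≈ s * proj₁ a

      -- a system of ideals for G (finite subsets of G represented by
      -- nonempty lists of representatives in K^×)
      record IsSystemOfIdeals {t} (_▷_ : List⁺ Kˣ → Kˣ → Set t)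
             : Set (c ⊔ ℓ ⊔ r ⊔ t) where
        field
          sys-refl  : ∀ a → [ a ] ▷ a
          sys-extend : ∀ {A A' b} → A ⊆ₛ A' → A ▷ b → A' ▷ b
          sys-cut   : ∀ {A b d} → A ▷ d → (d ∷⁺ A) ▷ b → A ▷ b
          sys-order : ∀ {a b} → a ≤G b → [ a ] ▷ b
          sys-shift : ∀ y {A b} → A ▷ b → map⁺ (y ·_) A ▷ (y · b)

      _▷d_ : List⁺ Kˣ → Kˣ → Set (c ⊔ ℓ ⊔ r)
      A ▷d b = b ∈⟨ A ⟩[ R ]

      -- T is the finest system of ideals (among systems with relations in
      -- level t) that contains ▷d and satisfies 1 ▷ x, i.e. T = (▷d)_x.
      record IsForcedDedekind {t t'} (x : Kˣ) (T : List⁺ Kˣ → Kˣ → Set t')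
             : Set (Level.suc t ⊔ c ⊔ ℓ ⊔ r ⊔ t') where
        field
          isSystem : IsSystemOfIdeals T
          ⊇d       : ∀ {A b} → A ▷d b → T A b
          forces   : T [ oneˣ ] x
          finest   : (_▷_ : List⁺ Kˣ → Kˣ → Set t) → IsSystemOfIdeals _▷_ →
                     (∀ {A b} → A ▷d b → A ▷ b) → [ oneˣ ] ▷ x →
                     ∀ {A b} → T A b → A ▷ b

-- Since R[x] is a subring of K containing R and x, the R[x]-spans form a
-- system of ideals containing ▷d with 1 ▷ x.  Conversely, in any such system
-- ▷, shifting 1 ▷ x by a and cutting gives A ▷ a·x whenever A ▷ a, hence
-- A ▷ a·xⁱ for every a ∈ A and every i.  An element b of ⟨A⟩_{R[x]} is an
-- R-linear combination of finitely many such a·xⁱ, so b is a Dedekind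
-- consequence of A together with them, and cutting them away gives A ▷ b.
module Submission where

open import Defs
open import Level using (Level; lift)
open import Data.Nat using (zero; suc)
open import Algebra.Bundles using (CommutativeRing)
import Algebra.Properties.Ring as RingProperties
open import Relation.Unary using (Pred)
open import Data.Product using (proj₁; ∃; _×_; _,_)
open import Data.List using (List; []; _∷_; _++_; map; iterate; length)
open import Data.List.Properties using (map-++; map-∘)
open import Data.List.NonEmpty using (List⁺; [_]; _∷⁺_; _++⁺_; toList) renaming (map to map⁺)
open import Data.List.Membership.Propositional using (_∈_)
open import Data.List.Relation.Unary.Any as Any using (Any; here; there)
import Data.List.Relation.Unary.Any.Properties as Anyₚ
open import Data.List.Relation.Unary.All as All using (All; []; _∷_; tabulate)
import Data.List.Relation.Unary.All.Properties as Allₚ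
import Relation.Binary.PropositionalEquality as ≡

module _ {c ℓ} (K : CommutativeRing c ℓ) where
  open CommutativeRing K
  open import Algebra.Solver.Ring.NaturalCoefficients.Default commutativeSemiring
    using (solve; _:+_; _:*_; _:=_)

  span-resp : ∀ {s} {S : Pred Carrier s} l {u v} → u ≈ v → Span K S l u → Span K S l v
  span-resp []      u≈v (lift u≈0)              = lift (trans (sym u≈v) u≈0)
  span-resp (a ∷ l) u≈v (s , d , Ss , d∈ , u≈) = s , d , Ss , d∈ , trans (sym u≈v) u≈

  span-mono : ∀ {s s'} {S : Pred Carrier s} {S' : Pred Carrier s'} → (∀ {k} → S k → S' k) →
              ∀ l {u} → Span K S l u → Span K S' l u
  span-mono S⊆S' []      (lift u≈0)              = lift u≈0
  span-mono S⊆S' (a ∷ l) (s , d , Ss , d∈ , u≈) = s , d , S⊆S' Ss , span-mono S⊆S' l d∈ , u≈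

  ∈⇒∈ₛ : ∀ A {a : Kˣ K} → a ∈ toList A → _∈ₛ_ K a A
  ∈⇒∈ₛ A = Any.map (λ { ≡.refl → refl })

  ⊆ₛ-++⁺ : ∀ L A → _⊆ₛ_ K A (L ++⁺ A)
  ⊆ₛ-++⁺ []      A a a∈ = a∈
  ⊆ₛ-++⁺ (d ∷ L) A a a∈ = there (⊆ₛ-++⁺ L A a a∈)

  elems-++⁺ : ∀ L A → elems K (L ++⁺ A) ≡.≡ map proj₁ L ++ elems K A
  elems-++⁺ []      A = ≡.refl
  elems-++⁺ (d ∷ L) A = ≡.cong (proj₁ d ∷_) (elems-++⁺ L A)

  module SpanProperties {s} {S : Pred Carrier s} (S-sub : IsSubring K S) where
    open IsSubring S-sub

    span-0 : ∀ l → Span K S l 0#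
    span-0 []      = lift refl
    span-0 (a ∷ l) = 0# , 0# , 0∈ , span-0 l , sym (trans (+-identityʳ _) (zeroˡ a))

    span-+ : ∀ l {u v} → Span K S l u → Span K S l v → Span K S l (u + v)
    span-+ []      (lift u≈0) (lift v≈0) = lift (trans (+-cong u≈0 v≈0) (+-identityˡ 0#))
    span-+ (a ∷ l) (s , d , Ss , d∈ , u≈) (s' , d' , Ss' , d'∈ , v≈) =
      s + s' , d + d' , +-closed Ss Ss' , span-+ l d∈ d'∈ ,
      trans (+-cong u≈ v≈) (regroup s a d s' d')
      where
      regroup : ∀ s a d s' d' → (s * a + d) + (s' * a + d') ≈ (s + s') * a + (d + d')
      regroup = solve 5 (λ s a d s' d' →
        (s :* a :+ d) :+ (s' :* a :+ d') := (s :+ s') :* a :+ (d :+ d')) refl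

    span-*ˡ : ∀ {t} → S t → ∀ l {u} → Span K S l u → Span K S l (t * u)
    span-*ˡ {t} St []      (lift u≈0)              = lift (trans (*-congˡ u≈0) (zeroʳ t))
    span-*ˡ {t} St (a ∷ l) (s , d , Ss , d∈ , u≈) =
      t * s , t * d , *-closed St Ss , span-*ˡ St l d∈ , trans (*-congˡ u≈) (scale-step t s a d)
      where
      scale-step : ∀ t s a d → t * (s * a + d) ≈ (t * s) * a + t * d
      scale-step = solve 4 (λ t s a d → t :* (s :* a :+ d) := (t :* s) :* a :+ t :* d) refl

    span-map-* : ∀ y l {u} → Span K S l u → Span K S (map (y *_) l) (y * u)
    span-map-* y []      (lift u≈0)              = lift (trans (*-congˡ u≈0) (zeroʳ y))
    span-map-* y (a ∷ l) (s , d , Ss , d∈ , u≈) =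
      s , y * d , Ss , span-map-* y l d∈ , trans (*-congˡ u≈) (shift-step y s a d)
      where
      shift-step : ∀ y s a d → y * (s * a + d) ≈ s * (y * a) + y * d
      shift-step = solve 4 (λ y s a d → y :* (s :* a :+ d) := s :* (y :* a) :+ y :* d) refl

    span-++ : ∀ l l' {u v} → Span K S l u → Span K S l' v → Span K S (l ++ l') (u + v)
    span-++ []      l' {u} {v} (lift u≈0) v∈ =
      span-resp l' (sym (trans (+-congʳ u≈0) (+-identityˡ v))) v∈
    span-++ (a ∷ l) l' (s , d , Ss , d∈ , u≈) v∈ =
      s , _ , Ss , span-++ l l' d∈ v∈ , trans (+-congʳ u≈) (+-assoc _ _ _)

    span-∈ : ∀ l {u} → Any (u ≈_) l → Span K S l u
    span-∈ (a ∷ l)     (here u≈a) =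
      1# , 0# , 1∈ , span-0 l , trans u≈a (sym (trans (+-identityʳ _) (*-identityˡ a)))
    span-∈ (a ∷ l) {u} (there u∈) =
      0# , u , 0∈ , span-∈ l u∈ , sym (trans (+-congʳ (zeroˡ a)) (+-identityˡ u))

    span-∈ₛ : ∀ A a → _∈ₛ_ K a A → Span K S (elems K A) (proj₁ a)
    span-∈ₛ A a a∈ = span-∈ (elems K A) (Anyₚ.map⁺ a∈)

    span-singleton : ∀ {t} a → S t → Span K S (a ∷ []) (t * a)
    span-singleton a St = _ , 0# , St , lift refl , sym (+-identityʳ _)

    span-⊆ : ∀ l l' → All (Span K S l') l → ∀ {u} → Span K S l u → Span K S l' u
    span-⊆ []      l' []           (lift u≈0)              = span-resp l' (sym u≈0) (span-0 l')
    span-⊆ (a ∷ l) l' (a∈ ∷ l⊆l') (s , d , Ss , d∈ , u≈) =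
      span-resp l' (sym u≈) (span-+ l' (span-*ˡ Ss l' a∈) (span-⊆ l l' l⊆l' d∈))

    span-cut : ∀ l {d u} → Span K S l d → Span K S (d ∷ l) u → Span K S l u
    span-cut l d∈ (s , e , Ss , e∈ , u≈) = span-resp l (sym u≈) (span-+ l (span-*ˡ Ss l d∈) e∈)

  module PolynomialProperties {r} {R : Pred Carrier r} (R-sub : IsSubring K R) (X : Carrier) where
    open IsSubring R-sub
    open RingProperties ring using (-1*x≈-x)

    _+ₚ_ : List Carrier → List Carrier → List Carrier
    []       +ₚ q        = q
    (a ∷ p)  +ₚ []       = a ∷ p
    (a ∷ p)  +ₚ (b ∷ q)  = a + b ∷ (p +ₚ q)

    evalPoly-+ : ∀ p q → evalPoly K X (p +ₚ q) ≈ evalPoly K X p + evalPoly K X q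
    evalPoly-+ []      q       = sym (+-identityˡ _)
    evalPoly-+ (a ∷ p) []      = sym (+-identityʳ _)
    evalPoly-+ (a ∷ p) (b ∷ q) =
      trans (+-congˡ (*-congˡ (evalPoly-+ p q)))
        (regroup a b X (evalPoly K X p) (evalPoly K X q))
      where
      regroup : ∀ a b X P Q → (a + b) + X * (P + Q) ≈ (a + X * P) + (b + X * Q)
      regroup = solve 5 (λ a b X P Q →
        (a :+ b) :+ X :* (P :+ Q) := (a :+ X :* P) :+ (b :+ X :* Q)) refl

    +ₚ-closed : ∀ {p q} → All R p → All R q → All R (p +ₚ q)
    +ₚ-closed []         Rq         = Rq
    +ₚ-closed (Ra ∷ Rp)  []         = Ra ∷ Rp
    +ₚ-closed (Ra ∷ Rp)  (Rb ∷ Rq)  = +-closed Ra Rb ∷ +ₚ-closed Rp Rq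

    evalPoly-map-* : ∀ t p → evalPoly K X (map (t *_) p) ≈ t * evalPoly K X p
    evalPoly-map-* t []      = sym (zeroʳ t)
    evalPoly-map-* t (a ∷ p) =
      trans (+-congˡ (*-congˡ (evalPoly-map-* t p))) (horner-scale t a X (evalPoly K X p))
      where
      horner-scale : ∀ t a X P → t * a + X * (t * P) ≈ t * (a + X * P)
      horner-scale = solve 4 (λ t a X P → t :* a :+ X :* (t :* P) := t :* (a :+ X :* P)) refl

    Adjoin-resp : ∀ {u v} → u ≈ v → Adjoin K R X u → Adjoin K R X v
    Adjoin-resp u≈v (p , Rp , u≈) = p , Rp , trans (sym u≈v) u≈

    R⊆Adjoin : ∀ {k} → R k → Adjoin K R X k
    R⊆Adjoin {k} Rk = k ∷ [] , Rk ∷ [] , sym (trans (+-congˡ (zeroʳ X)) (+-identityʳ k))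

    X∈Adjoin : Adjoin K R X X
    X∈Adjoin = 0# ∷ 1# ∷ [] , 0∈ ∷ 1∈ ∷ [] ,
      sym (trans (+-identityˡ _)
        (trans (*-congˡ (trans (+-congˡ (zeroʳ X)) (+-identityʳ 1#))) (*-identityʳ X)))

    Adjoin-+ : ∀ {u v} → Adjoin K R X u → Adjoin K R X v → Adjoin K R X (u + v)
    Adjoin-+ (p , Rp , u≈) (q , Rq , v≈) =
      p +ₚ q , +ₚ-closed Rp Rq , trans (+-cong u≈ v≈) (sym (evalPoly-+ p q))

    Adjoin-*ˡ : ∀ {t u} → R t → Adjoin K R X u → Adjoin K R X (t * u)
    Adjoin-*ˡ {t} Rt (p , Rp , u≈) =
      map (t *_) p , Allₚ.map⁺ (All.map (*-closed Rt) Rp) ,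
      trans (*-congˡ u≈) (sym (evalPoly-map-* t p))

    Adjoin-X* : ∀ {u} → Adjoin K R X u → Adjoin K R X (X * u)
    Adjoin-X* (p , Rp , u≈) = 0# ∷ p , 0∈ ∷ Rp , trans (*-congˡ u≈) (sym (+-identityˡ _))

    evalPoly-*-Adjoin : ∀ p → All R p → ∀ {v} → Adjoin K R X v →
                        Adjoin K R X (evalPoly K X p * v)
    evalPoly-*-Adjoin []      []        {v} _  = Adjoin-resp (sym (zeroˡ v)) (R⊆Adjoin 0∈)
    evalPoly-*-Adjoin (a ∷ p) (Ra ∷ Rp) {v} v∈ =
      Adjoin-resp (sym (expand a X (evalPoly K X p) v))
        (Adjoin-+ (Adjoin-*ˡ Ra v∈) (Adjoin-X* (evalPoly-*-Adjoin p Rp v∈)))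
      where
      expand : ∀ a X P v → (a + X * P) * v ≈ a * v + X * (P * v)
      expand = solve 4 (λ a X P v → (a :+ X :* P) :* v := a :* v :+ X :* (P :* v)) refl

    Adjoin-isSubring : IsSubring K (Adjoin K R X)
    Adjoin-isSubring = record
      { resp       = Adjoin-resp
      ; 0∈         = R⊆Adjoin 0∈
      ; 1∈         = R⊆Adjoin 1∈
      ; +-closed   = Adjoin-+
      ; neg-closed = λ {u} u∈ → Adjoin-resp (-1*x≈-x u) (Adjoin-*ˡ (neg-closed 1∈) u∈)
      ; *-closed   = λ { (p , Rp , u≈) v∈ →
          Adjoin-resp (*-congʳ (sym u≈)) (evalPoly-*-Adjoin p Rp v∈) }
      }

  module _ (isField : IsField K) {r} {R : Pred Carrier r} (R-sub : IsSubring K R) where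
    private
      _·ˣ_ : Kˣ K → Kˣ K → Kˣ K
      _·ˣ_ = _·_ K isField

    elems-map⁺ : ∀ y A → elems K (map⁺ (y ·ˣ_) A) ≡.≡ map (proj₁ y *_) (elems K A)
    elems-map⁺ y A = ≡.trans (≡.sym (map-∘ (toList A))) (map-∘ (toList A))

    span-isSystemOfIdeals : ∀ {s} {S : Pred Carrier s} → IsSubring K S →
                            (∀ {k} → R k → S k) →
                            IsSystemOfIdeals K isField R (λ A b → _∈⟨_⟩[_] K b A S)
    span-isSystemOfIdeals {S = S} S-sub R⊆S = record
      { sys-refl   = λ a → span-∈ₛ [ a ] a (here refl)
      ; sys-extend = λ {A} {A'} A⊆A' → span-⊆ (elems K A) (elems K A')
          (Allₚ.map⁺ (tabulate (λ {a} a∈ → span-∈ₛ A' a (A⊆A' a (∈⇒∈ₛ A a∈)))))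
      ; sys-cut    = λ {A} → span-cut (elems K A)
      ; sys-order  = λ { {a} (s , Rs , b≈) →
          span-resp (proj₁ a ∷ []) (sym b≈) (span-singleton (proj₁ a) (R⊆S Rs)) }
      ; sys-shift  = λ y {A} {b} b∈ →
          ≡.subst (λ l → Span K S l (proj₁ y * proj₁ b)) (≡.sym (elems-map⁺ y A))
            (span-map-* (proj₁ y) (elems K A) b∈)
      }
      where open SpanProperties S-sub

    module ForcedSystem (x : Kˣ K) {t} (_▷_ : List⁺ (Kˣ K) → Kˣ K → Set t)
                  (sys : IsSystemOfIdeals K isField R _▷_)
                  (▷d⊆▷ : ∀ {A b} → _▷d_ K isField R A b → A ▷ b)
                  (1▷x : [ oneˣ K isField ] ▷ x) where
      open IsSystemOfIdeals sys
      open SpanProperties R-sub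
      open PolynomialProperties R-sub (proj₁ x)

      ▷-·x : ∀ {A a} → A ▷ a → A ▷ (a ·ˣ x)
      ▷-·x {A} {a} A▷a = sys-cut A▷a (sys-extend a·1∈ (sys-shift a 1▷x))
        where
        a·1∈ : _⊆ₛ_ K [ a ·ˣ oneˣ K isField ] (a ∷⁺ A)
        a·1∈ _ (here b≈a·1) = here (trans b≈a·1 (*-identityʳ _))

      ▷-iterate-·x : ∀ {A a} n → A ▷ a → All (A ▷_) (iterate (_·ˣ x) a n)
      ▷-iterate-·x zero    A▷a = []
      ▷-iterate-·x (suc n) A▷a = A▷a ∷ ▷-iterate-·x n (▷-·x A▷a)

      evalPoly-*-span : ∀ a p → All R p →
                        Span K R (map proj₁ (iterate (_·ˣ x) a (length p)))
                                 (evalPoly K (proj₁ x) p * proj₁ a)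
      evalPoly-*-span a []      []        = lift (zeroˡ _)
      evalPoly-*-span a (r ∷ p) (Rr ∷ Rp) =
        r , _ , Rr , evalPoly-*-span (a ·ˣ x) p Rp ,
        expand r (proj₁ x) (evalPoly K (proj₁ x) p) (proj₁ a)
        where
        expand : ∀ r X P a → (r + X * P) * a ≈ r * a + P * (a * X)
        expand = solve 4 (λ r X P a → (r :+ X :* P) :* a := r :* a :+ P :* (a :* X)) refl

      Adjoin-span⇒span : ∀ {A} l {k} → All (A ▷_) l →
                         Span K (Adjoin K R (proj₁ x)) (map proj₁ l) k →
                         ∃ λ L → All (A ▷_) L × Span K R (map proj₁ L) k
      Adjoin-span⇒span []      []         (lift k≈0) = [] , [] , lift k≈0
      Adjoin-span⇒span (a ∷ l) (A▷a ∷ l▷) (_ , _ , (p , Rp , s≈) , d∈ , k≈) =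
        let L , L▷ , d∈' = Adjoin-span⇒span l l▷ d∈
            P = iterate (_·ˣ x) a (length p)
        in P ++ L , Allₚ.++⁺ (▷-iterate-·x (length p) A▷a) L▷ ,
           ≡.subst (λ l → Span K R l _) (≡.sym (map-++ proj₁ P L))
             (span-resp (map proj₁ P ++ map proj₁ L) (sym (trans k≈ (+-congʳ (*-congʳ s≈))))
               (span-++ (map proj₁ P) (map proj₁ L) (evalPoly-*-span a p Rp) d∈'))

      ▷-cut-all : ∀ L {A b} → All (A ▷_) L → (L ++⁺ A) ▷ b → A ▷ b
      ▷-cut-all []      []         L++A▷b = L++A▷b
      ▷-cut-all (d ∷ L) {A} (A▷d ∷ L▷) L++A▷b =
        ▷-cut-all L L▷ (sys-cut (sys-extend (⊆ₛ-++⁺ L A) A▷d) L++A▷b)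

      ▷-span : ∀ L {A b} → All (A ▷_) L → Span K R (map proj₁ L) (proj₁ b) → A ▷ b
      ▷-span L {A} L▷ b∈ = ▷-cut-all L L▷ (▷d⊆▷
        (≡.subst (λ l → Span K R l _) (≡.sym (elems-++⁺ L A))
          (span-resp (map proj₁ L ++ elems K A) (+-identityʳ _)
            (span-++ (map proj₁ L) (elems K A) b∈ (span-0 (elems K A))))))

      Adjoin-span⇒▷ : ∀ {A b} → _∈⟨_⟩[_] K b A (Adjoin K R (proj₁ x)) → A ▷ b
      Adjoin-span⇒▷ {A} b∈ =
        let A▷A = tabulate (λ {a} a∈ → ▷d⊆▷ (span-∈ₛ A a (∈⇒∈ₛ A a∈)))
            L , L▷ , b∈' = Adjoin-span⇒span (toList A) A▷A b∈
        in ▷-span L L▷ b∈'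

proposition1p16 : ∀ {c ℓ r} (t : Level) (K : CommutativeRing c ℓ) (isField : IsField K)
                  (R : Pred (CommutativeRing.Carrier K) r) → IsSubring K R → IsFractionFieldOf K R →
                  (x : Kˣ K) →
                  IsForcedDedekind K isField R {t} x (λ A b → _∈⟨_⟩[_] K b A (Adjoin K R (proj₁ x)))
proposition1p16 t K isField R R-sub _ x = record
  { isSystem = span-isSystemOfIdeals K isField R-sub Adjoin-isSubring R⊆Adjoin
  ; ⊇d       = λ {A} → span-mono K R⊆Adjoin (elems K A)
  ; forces   = span-resp K (1# ∷ []) (*-identityʳ _) (span-singleton 1# X∈Adjoin)
  ; finest   = λ _▷_ sys ▷d⊆▷ 1▷x →
      ForcedSystem.Adjoin-span⇒▷ K isField R-sub x _▷_ sys ▷d⊆▷ 1▷x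
  }
  where
  open CommutativeRing K using (1#; *-identityʳ)
  open PolynomialProperties K R-sub (proj₁ x)
  open SpanProperties K Adjoin-isSubring
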